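{- Let $T$ be a tree of order $n\ge 4$ such that its complement $\overline{T}$ is connected. Then $$2|\mathrm{leaf}(T)|+2|\mathrm{leaf}(\overline{T})|\le \gamma_{tc}(M(T))+\gamma_{tc}(M(\overline{T}))\le \frac{n^2+3n-8}{2}.$$
   Context: All graphs are finite, simple and undirected; $\overline{T}$ is the complement of $T$, and $\mathrm{leaf}(H)=\{v\in V(H)\mid \deg_H(v)=1\}$. For a graph $H$, a set $D\subseteq V(H)$ is a total dominating set if every vertex of $H$ has a neighbor in $D$. A set $D\subseteq V(H)$ is a total outer-connected dominating set of $H$ if $D$ is a total dominating set and the induced subgraph $H[V(H)\setminus D]$ is connected; $\gamma_{tc}(H)$ denotes the minimum cardinality of a total outer-connected dominating set of $H$. The middle graph $M(G)$ of a graph $G$ has vertex set $V(G)\cup E(G)$, where two elements $x,y$ are adjacent iff either $x,y\in E(G)$ are edges of $G$ sharing an endpoint, or one of them is a vertex of $G$ and the other is an edge of $G$ incident to it. -}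

module Defs where

open import Data.Bool using (Bool; true; false; not; if_then_else_; _∧_; _∨_)
open import Data.Nat using (ℕ; zero; suc; _+_; _*_; _∸_; _≤_; _<_)
import Data.Nat as ℕ
open import Data.Fin using (Fin; zero; suc; toℕ; inject₁; fromℕ; splitAt; _≟_)
open import Data.Fin.Properties using () renaming (_≟_ to _≟F_)
open import Data.List using (List; []; _∷_; length; filter; allFin; concatMap; lookup)
open import Data.Product using (_×_; _,_; proj₁; proj₂; ∃; Σ-syntax)
open import Data.Sum using (inj₁; inj₂)
open import Relation.Nullary using (¬_; Dec; yes; no)
open import Relation.Nullary.Decidable using (⌊_⌋)
open import Relation.Binary.PropositionalEquality using (_≡_)
open import Function.Definitions using (Injective)

Adj : ℕ → Set
Adj n = Fin n → Fin n → Bool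

Symmetric : ∀ {n} → Adj n → Set
Symmetric A = ∀ u v → A u v ≡ A v u

Irreflexive : ∀ {n} → Adj n → Set
Irreflexive A = ∀ u → A u u ≡ false

IsSimpleGraph : ∀ {n} → Adj n → Set
IsSimpleGraph A = Symmetric A × Irreflexive A

complement : ∀ {n} → Adj n → Adj n
complement A u v = if ⌊ u ≟ v ⌋ then false else not (A u v)

count : ∀ {m} → (Fin m → Bool) → ℕ
count {m} P = length (filter (λ v → P v Data.Bool.≟ true) (allFin m))
  where import Data.Bool

degree : ∀ {n} → Adj n → Fin n → ℕ
degree A v = count (A v)

leafCount : ∀ {n} → Adj n → ℕ
leafCount A = count (λ v → ⌊ degree A v ℕ.≟ 1 ⌋)

-- walks inside a vertex subset S (S given as a Boolean predicate):
-- a walk from u to v all of whose vertices after u lie in S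
data Walk {m} (A : Adj m) (S : Fin m → Bool) : Fin m → Fin m → Set where
  here : ∀ {u} → Walk A S u u
  step : ∀ {u w v} → A u w ≡ true → S w ≡ true → Walk A S w v → Walk A S u v

InducedConnected : ∀ {m} → Adj m → (Fin m → Bool) → Set
InducedConnected A S = ∀ u v → S u ≡ true → S v ≡ true → Walk A S u v

Connected : ∀ {m} → Adj m → Set
Connected A = InducedConnected A (λ _ → true)

HasCycle : ∀ {n} → Adj n → Set
HasCycle {n} A =
  ∃ λ k → Σ[ c ∈ (Fin (suc (suc (suc k))) → Fin n) ]
    Injective _≡_ _≡_ c
    × (∀ (i : Fin (suc (suc k))) → A (c (inject₁ i)) (c (suc i)) ≡ true)
    × A (c (fromℕ (suc (suc k)))) (c zero) ≡ true

IsTree : ∀ {n} → Adj n → Set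
IsTree A = IsSimpleGraph A × Connected A × ¬ HasCycle A

edgeList : ∀ {n} → Adj n → List (Fin n × Fin n)
edgeList {n} A =
  filter (λ e → (Data.Bool._∧_ (⌊ toℕ (proj₁ e) ℕ.<? toℕ (proj₂ e) ⌋) (A (proj₁ e) (proj₂ e))) Data.Bool.≟ true)
    (concatMap (λ i → Data.List.map (λ j → (i , j)) (allFin n)) (allFin n))
  where import Data.Bool; import Data.List

numEdges : ∀ {n} → Adj n → ℕ
numEdges A = length (edgeList A)

private
  edgeAt : ∀ {n} (A : Adj n) → Fin (numEdges A) → Fin n × Fin n
  edgeAt A k = lookup (edgeList A) k

  incident : ∀ {n} → Fin n → Fin n × Fin n → Bool
  incident u e = ⌊ u ≟ proj₁ e ⌋ ∨ ⌊ u ≟ proj₂ e ⌋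

  shareEnd : ∀ {n} → Fin n × Fin n → Fin n × Fin n → Bool
  shareEnd e f = incident (proj₁ e) f ∨ incident (proj₂ e) f

-- middle graph M(G): vertices Fin n (vertices of G) followed by
-- Fin (numEdges G) (edges of G)
middle : ∀ {n} → (A : Adj n) → Adj (n + numEdges A)
middle {n} A x y with splitAt n x | splitAt n y
... | inj₁ u | inj₁ v = false
... | inj₁ u | inj₂ e = incident u (edgeAt A e)
... | inj₂ e | inj₁ u = incident u (edgeAt A e)
... | inj₂ e | inj₂ f = not ⌊ e ≟ f ⌋ ∧ shareEnd (edgeAt A e) (edgeAt A f)

TotalDominating : ∀ {m} → Adj m → (Fin m → Bool) → Set
TotalDominating A D = ∀ v → ∃ λ u → D u ≡ true × A v u ≡ true

IsTOCDS : ∀ {m} → Adj m → (Fin m → Bool) → Set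
IsTOCDS A D = TotalDominating A D × InducedConnected A (λ v → not (D v))

IsGammaTC : ∀ {m} → Adj m → ℕ → Set
IsGammaTC A k =
  (∃ λ D → IsTOCDS A D × count D ≡ k) × (∀ D → IsTOCDS A D → k ≤ count D)

-- Let G be T or its complement; both are connected and have n ≥ 3 vertices, so no two leaves of G
-- are adjacent. In a total outer-connected dominating set D of M(G) every vertex x of G is dominated
-- by an edge at x, and leaves get distinct such edges. A leaf outside D has its edge as its only
-- neighbour in M(G), so connectivity of the rest forces every other element into D; hence a leaf or,
-- failing that, its neighbour is a vertex of D, again injectively. So γtc(M(G)) ≥ 2|leaf(G)|.
-- Conversely, G is not a star (its complement is connected), so some edge vw has further neighbours
-- v′ of v and w′ of w, and everything except v and vw is a total outer-connected dominating set:
-- γtc(M(G)) ≤ n + m(G) − 2. Summing over G = T, T̄ with m(T) + m(T̄) = n(n − 1)/2 gives the upper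
-- bound.

module Submission where

open import Defs
open import Data.Nat using (ℕ; zero; suc; _+_; _*_; _∸_; _≤_; _<_; z≤n; s≤s)
open import Data.Product using (_×_; _,_; proj₁; proj₂; ∃; ∃₂)

open import Data.Bool using (Bool; true; false; not; _∧_; _∨_; if_then_else_)
import Data.Bool as Bool
open import Data.Bool.Properties using (not-involutive; ∧-identityʳ)
import Data.Nat as ℕ
open import Data.Nat.Properties
open import Data.Nat.Induction using (<-rec)
open import Data.Nat.Tactic.RingSolver using (solve-∀)
open import Data.Fin using (Fin; zero; suc; toℕ; fromℕ<; _↑ˡ_; _↑ʳ_; splitAt)
import Data.Fin as Fin
import Data.Fin.Properties as Finₚ
open import Data.Fin.Properties
  using (any?; all?; toℕ<n; toℕ-fromℕ<; toℕ-injective;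
         splitAt-↑ˡ; splitAt-↑ʳ; splitAt⁻¹-↑ˡ; splitAt⁻¹-↑ʳ)
open import Data.Fin.Subset.Properties using (anySubset?)
open import Data.List using (List; []; _∷_; length; filter; allFin; concatMap; lookup; tabulate)
import Data.List as List
open import Data.List.Properties using (length-++; filter-++; map-tabulate)
open import Data.List.Membership.Propositional using (_∈_)
open import Data.List.Membership.Propositional.Properties using (∈-filter⁻; ∈-filter⁺; ∈-lookup; ∈-cartesianProduct⁺; ∈-allFin)
import Data.List.Relation.Unary.All as All
open import Data.List.Relation.Unary.AllPairs using (_∷_)
import Data.List.Relation.Unary.Any as Any
open import Data.List.Relation.Unary.Any.Properties using (lookup-index)
open import Data.List.Relation.Unary.Unique.Propositional using (Unique)
import Data.List.Relation.Unary.Unique.Propositional.Properties as Unique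
open import Relation.Binary.Definitions using (tri<; tri≈; tri>)
import Data.Vec as Vec
open import Data.Vec.Properties using (lookup∘tabulate)
open import Data.Sum using (_⊎_; inj₁; inj₂)
import Data.Sum as Sum
open import Data.Empty using (⊥; ⊥-elim)
open import Relation.Nullary using (¬_; Dec; yes; no; contradiction)
open import Relation.Nullary.Decidable using (⌊_⌋; _×-dec_; _→-dec_; ¬?; map′)
open import Relation.Binary.PropositionalEquality
open import Function using (_∘_; id; case_of_)
open import Algebra.Properties.CommutativeSemigroup +-commutativeSemigroup using (interchange)

∑ : ∀ {k} → (Fin k → ℕ) → ℕ
∑ {zero} f = 0
∑ {suc k} f = f zero + ∑ (f ∘ suc)

∑-cong : ∀ {k} {f g : Fin k → ℕ} → (∀ i → f i ≡ g i) → ∑ f ≡ ∑ g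
∑-cong {zero} f≗g = refl
∑-cong {suc k} f≗g = cong₂ _+_ (f≗g zero) (∑-cong (f≗g ∘ suc))

∑-+ : ∀ {k} (f g : Fin k → ℕ) → ∑ f + ∑ g ≡ ∑ (λ i → f i + g i)
∑-+ {zero} f g = refl
∑-+ {suc k} f g = trans (interchange (f zero) _ (g zero) _) (cong (f zero + g zero +_) (∑-+ (f ∘ suc) (g ∘ suc)))

∑-↑ : ∀ n {e} (f : Fin (n + e) → ℕ) → ∑ f ≡ ∑ (λ i → f (i ↑ˡ e)) + ∑ (λ i → f (n ↑ʳ i))
∑-↑ zero f = refl
∑-↑ (suc n) f = trans (cong (f zero +_) (∑-↑ n (f ∘ suc))) (sym (+-assoc (f zero) _ _))

indicator : Bool → ℕ
indicator true = 1
indicator false = 0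

card : ∀ {m} → (Fin m → Bool) → ℕ
card P = ∑ (indicator ∘ P)

length-filter-tabulate : ∀ {A : Set} {m} (P : A → Bool) (f : Fin m → A) →
  length (filter (λ x → P x Bool.≟ true) (tabulate f)) ≡ card (P ∘ f)
length-filter-tabulate {m = zero} P f = refl
length-filter-tabulate {m = suc m} P f with P (f zero)
... | true = cong suc (length-filter-tabulate P (f ∘ suc))
... | false = length-filter-tabulate P (f ∘ suc)

count≡card : ∀ {m} (P : Fin m → Bool) → count P ≡ card P
count≡card P = length-filter-tabulate P id

card-cong : ∀ {m} {P Q : Fin m → Bool} → (∀ x → P x ≡ Q x) → card P ≡ card Q
card-cong P≗Q = ∑-cong (cong indicator ∘ P≗Q)

card≤ : ∀ {m} (P : Fin m → Bool) → card P ≤ m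
card≤ {zero} P = z≤n
card≤ {suc m} P with P zero
... | true = s≤s (card≤ (P ∘ suc))
... | false = m≤n⇒m≤1+n (card≤ (P ∘ suc))

card-full : ∀ m → card {m} (λ _ → true) ≡ m
card-full zero = refl
card-full (suc m) = cong suc (card-full m)

_─_ : ∀ {m} → (Fin m → Bool) → Fin m → Fin m → Bool
(P ─ u) x = P x ∧ not ⌊ x Fin.≟ u ⌋

─-⊆ : ∀ {m} (P : Fin m → Bool) {u x} → (P ─ u) x ≡ true → P x ≡ true
─-⊆ P {x = x} P─ux with P x
... | true = refl
... | false = P─ux

─-∋ : ∀ {m} (P : Fin m → Bool) {u x} → P x ≡ true → x ≢ u → (P ─ u) x ≡ true
─-∋ P {u} {x} Px x≢u with x Fin.≟ u
... | yes x≡u = contradiction x≡u x≢u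
... | no _ rewrite Px = refl

─-∌⁻ : ∀ {m} (P : Fin m → Bool) {u x} → (P ─ u) x ≡ false → P x ≡ false ⊎ x ≡ u
─-∌⁻ P {u} {x} P─ux with P x | x Fin.≟ u
... | false | _ = inj₁ refl
... | true | yes x≡u = inj₂ x≡u

card-─ : ∀ {m} (P : Fin m → Bool) (u : Fin m) → card P ≡ card (P ─ u) + indicator (P u)
card-─ {suc m} P zero with P zero
... | true = trans (cong suc (card-cong (λ i → sym (∧-identityʳ (P (suc i)))))) (+-comm 1 _)
... | false = trans (card-cong (λ i → sym (∧-identityʳ (P (suc i))))) (sym (+-identityʳ _))
card-─ {suc m} P (suc u) = begin
  indicator (P zero) + card (P ∘ suc)
    ≡⟨ cong (indicator (P zero) +_) (card-─ (P ∘ suc) u) ⟩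
  indicator (P zero) + (card ((P ∘ suc) ─ u) + indicator (P (suc u)))
    ≡⟨ +-assoc (indicator (P zero)) _ _ ⟨
  indicator (P zero) + card ((P ∘ suc) ─ u) + indicator (P (suc u))
    ≡⟨ cong (λ k → k + indicator (P (suc u))) (cong₂ _+_ (cong indicator (sym (∧-identityʳ (P zero))))
                                                        (card-cong (λ i → cong (λ b → P (suc i) ∧ not b) (≟-suc i u)))) ⟩
  card (P ─ suc u) + indicator (P (suc u)) ∎
  where
  open ≡-Reasoning
  ≟-suc : ∀ {k} (i u : Fin k) → ⌊ i Fin.≟ u ⌋ ≡ ⌊ suc i Fin.≟ suc u ⌋
  ≟-suc i u with i Fin.≟ u
  ... | yes refl = refl
  ... | no _ = refl

card-─-suc : ∀ {m} (P : Fin m → Bool) {u} → P u ≡ true → card P ≡ suc (card (P ─ u))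
card-─-suc P {u} Pu = trans (card-─ P u) (trans (cong (λ b → card (P ─ u) + indicator b) Pu) (+-comm _ 1))

card≢0 : ∀ {m} (P : Fin m → Bool) {u} → P u ≡ true → card P ≢ 0
card≢0 P Pu eq with () ← trans (sym (card-─-suc P Pu)) eq

card≢0-witness : ∀ {m} (P : Fin m → Bool) → card P ≢ 0 → ∃ λ u → P u ≡ true
card≢0-witness {zero} P card≢0 = contradiction refl card≢0
card≢0-witness {suc m} P card≢0 with P zero in P0
... | true = zero , P0
... | false with card≢0-witness (P ∘ suc) card≢0
... | u , Pu = suc u , Pu

card≡1-unique : ∀ {m} (P : Fin m → Bool) {u v} → card P ≡ 1 → P u ≡ true → P v ≡ true → v ≡ u
card≡1-unique P {u} {v} card≡1 Pu Pv with v Fin.≟ u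
... | yes v≡u = v≡u
... | no v≢u = contradiction (suc-injective (trans (sym (card-─-suc P Pu)) card≡1)) (card≢0 (P ─ u) (─-∋ P Pv v≢u))

card-↑ : ∀ n {e} (P : Fin (n + e) → Bool) → card P ≡ card (λ i → P (i ↑ˡ e)) + card (λ i → P (n ↑ʳ i))
card-↑ n P = ∑-↑ n (indicator ∘ P)

card-≤-injection : ∀ {m k} (P : Fin m → Bool) (Q : Fin k → Bool) (f : ∀ x → P x ≡ true → Fin k) →
  (∀ x Px → Q (f x Px) ≡ true) → (∀ x y Px Py → f x Px ≡ f y Py → x ≡ y) → card P ≤ card Q
card-≤-injection {zero} P Q f f∈Q f-inj = z≤n
card-≤-injection {suc m} P Q f f∈Q f-inj with P zero in P0
... | false = card-≤-injection (P ∘ suc) Q (f ∘ suc) (f∈Q ∘ suc) (λ x y Px Py → Finₚ.suc-injective ∘ f-inj _ _ Px Py)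
... | true = subst (suc (card (P ∘ suc)) ≤_) (sym (card-─-suc Q (f∈Q zero P0)))
  (s≤s (card-≤-injection (P ∘ suc) (Q ─ f zero P0) (f ∘ suc)
    (λ x Px → ─-∋ Q (f∈Q (suc x) Px) (Finₚ.0≢1+n ∘ sym ∘ f-inj (suc x) zero Px P0))
    (λ x y Px Py → Finₚ.suc-injective ∘ f-inj _ _ Px Py)))

walk-weaken : ∀ {m} {A : Adj m} {S S′ : Fin m → Bool} → (∀ x → S′ x ≡ true → S x ≡ true) →
  ∀ {u v} → Walk A S′ u v → Walk A S u v
walk-weaken S′⊆S here = here
walk-weaken S′⊆S (step a s r) = step a (S′⊆S _ s) (walk-weaken S′⊆S r)

walk-resp : ∀ {m} {A B : Adj m} {S : Fin m → Bool} → (∀ u v → A u v ≡ B u v) →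
  ∀ {u v} → Walk A S u v → Walk B S u v
walk-resp A≗B here = here
walk-resp A≗B (step a s r) = step (trans (sym (A≗B _ _)) a) s (walk-resp A≗B r)

walk-from-last-visit : ∀ {m} {A : Adj m} {S : Fin m → Bool} (x : Fin m) → ∀ {u v} →
  Walk A S u v → Walk A (S ─ x) u v ⊎ Walk A (S ─ x) x v
walk-from-last-visit x here = inj₁ here
walk-from-last-visit {S = S} x (step {w = w} a s r) with walk-from-last-visit x r
... | inj₂ r′ = inj₂ r′
... | inj₁ r′ with w Fin.≟ x
... | yes refl = inj₂ r′
... | no w≢x = inj₁ (step a (─-∋ S s w≢x) r′)

walk-avoiding-start : ∀ {m} {A : Adj m} {S : Fin m → Bool} {u v} → Walk A S u v → Walk A (S ─ u) u v
walk-avoiding-start {u = u} r with walk-from-last-visit u r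
... | inj₁ r′ = r′
... | inj₂ r′ = r′

FirstStep : ∀ {m} → Adj m → (Fin m → Bool) → Fin m → Fin m → Set
FirstStep A S u v = ∃ λ w → A u w ≡ true × (S ─ u) w ≡ true × Walk A (S ─ u) w v

walk⇒first-step : ∀ {m} {A : Adj m} {S : Fin m → Bool} {u v} → u ≢ v → Walk A S u v → FirstStep A S u v
walk⇒first-step u≢v r with walk-avoiding-start r
... | here = contradiction refl u≢v
... | step a s r′ = _ , a , s , r′

first-step⇒walk : ∀ {m} {A : Adj m} {S : Fin m → Bool} {u v} → FirstStep A S u v → Walk A S u v
first-step⇒walk {S = S} (w , a , s , r) = step a (─-⊆ S s) (walk-weaken (λ _ → ─-⊆ S) r)

-- Every first step shrinks the admissible vertex set, so the search is bounded by its size.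
walk?-within : ∀ {m} (A : Adj m) (f : ℕ) (S : Fin m → Bool) (u v : Fin m) → card (S ─ u) ≤ f → Dec (Walk A S u v)
walk?-within A f S u v bound with u Fin.≟ v
... | yes refl = yes here
... | no u≢v = map′ first-step⇒walk (walk⇒first-step u≢v) (first-step? f bound)
  where
  first-step? : ∀ f → card (S ─ u) ≤ f → Dec (FirstStep A S u v)
  first-step? zero bound = no λ (_ , _ , s , _) → card≢0 (S ─ u) s (n≤0⇒n≡0 bound)
  first-step? (suc f) bound = any? λ w → (A u w Bool.≟ true) ×-dec continue? w
    where
    continue? : ∀ w → Dec ((S ─ u) w ≡ true × Walk A (S ─ u) w v)
    continue? w with (S ─ u) w in s
    ... | false = no λ ()
    ... | true = map′ (refl ,_) proj₂
      (walk?-within A f (S ─ u) w v (≤-pred (subst (_≤ suc f) (card-─-suc (S ─ u) s) bound)))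

walk? : ∀ {m} (A : Adj m) (S : Fin m → Bool) (u v : Fin m) → Dec (Walk A S u v)
walk? {m} A S u v = walk?-within A m S u v (card≤ (S ─ u))

inducedConnected? : ∀ {m} (A : Adj m) (S : Fin m → Bool) → Dec (InducedConnected A S)
inducedConnected? A S = all? λ u → all? λ v → (S u Bool.≟ true) →-dec (S v Bool.≟ true) →-dec walk? A S u v

isTOCDS? : ∀ {m} (A : Adj m) (D : Fin m → Bool) → Dec (IsTOCDS A D)
isTOCDS? A D = (all? λ v → any? λ u → (D u Bool.≟ true) ×-dec (A v u Bool.≟ true)) ×-dec inducedConnected? A (not ∘ D)

IsTOCDS-resp : ∀ {m} (A : Adj m) {D D′ : Fin m → Bool} → (∀ x → D x ≡ D′ x) → IsTOCDS A D → IsTOCDS A D′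
IsTOCDS-resp A D≗D′ (dominating , connected) =
  (λ v → let (u , Du , a) = dominating v in u , trans (sym (D≗D′ u)) Du , a) ,
  (λ u v su sv → walk-weaken (λ x s → trans (cong not (sym (D≗D′ x))) s)
                    (connected u v (trans (cong not (D≗D′ u)) su) (trans (cong not (D≗D′ v)) sv)))

least : {P : ℕ → Set} → (∀ k → Dec (P k)) → ∀ b → P b → ∃ λ k → P k × (∀ j → P j → k ≤ j)
least {P} P? = <-rec (λ b → P b → ∃ λ k → P k × (∀ j → P j → k ≤ j)) search
  where
  search : ∀ b → (∀ {c} → c < b → P c → ∃ λ k → P k × (∀ j → P j → k ≤ j)) → P b → ∃ λ k → P k × (∀ j → P j → k ≤ j)
  search b smaller Pb with any? {n = b} (P? ∘ toℕ)
  ... | yes (i , Pi) = smaller (toℕ<n i) Pi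
  ... | no none = b , Pb , λ j Pj → ≮⇒≥ λ j<b → none (fromℕ< j<b , subst P (sym (toℕ-fromℕ< j<b)) Pj)

γtc-exists : ∀ {m} (A : Adj m) (D : Fin m → Bool) → IsTOCDS A D → ∃ λ k → IsGammaTC A k × k ≤ count D
γtc-exists {m} A D tD with least realised? (count D) (D , tD , refl)
  where
  Realised : ℕ → Set
  Realised k = ∃ λ D → IsTOCDS A D × count D ≡ k
  realised? : ∀ k → Dec (Realised k)
  realised? k = map′ (λ (s , t , c) → Vec.lookup s , t , c) from-function
    (anySubset? λ s → isTOCDS? A (Vec.lookup s) ×-dec (count (Vec.lookup s) ℕ.≟ k))
    where
    from-function : Realised k → ∃ λ s → IsTOCDS A (Vec.lookup s) × count (Vec.lookup s) ≡ k
    from-function (D , t , c) = Vec.tabulate D , IsTOCDS-resp A (sym ∘ lookup∘tabulate D) t ,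
      trans (trans (count≡card (Vec.lookup (Vec.tabulate D))) (trans (card-cong (lookup∘tabulate D)) (sym (count≡card D)))) c
... | k , realised , minimal = k , (realised , λ D′ tD′ → minimal _ (D′ , tD′ , refl)) , minimal _ (D , tD , refl)

Unique-lookup-injective : ∀ {A : Set} {xs : List A} → Unique xs → ∀ i j → lookup xs i ≡ lookup xs j → i ≡ j
Unique-lookup-injective (x∉ ∷ u) zero zero _ = refl
Unique-lookup-injective (x∉ ∷ u) zero (suc j) eq = contradiction eq (All.lookup x∉ (∈-lookup j))
Unique-lookup-injective (x∉ ∷ u) (suc i) zero eq = contradiction (sym eq) (All.lookup x∉ (∈-lookup i))
Unique-lookup-injective (x∉ ∷ u) (suc i) (suc j) eq = cong suc (Unique-lookup-injective u i j eq)

concatMap-pairs : ∀ {A B : Set} (xs : List A) (ys : List B) →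
  concatMap (λ i → List.map (i ,_) ys) xs ≡ List.cartesianProduct xs ys
concatMap-pairs [] ys = refl
concatMap-pairs (x ∷ xs) ys = cong (List.map (x ,_) ys List.++_) (concatMap-pairs xs ys)

<?⇒< : ∀ {a b} → ⌊ a ℕ.<? b ⌋ ≡ true → a < b
<?⇒< {a} {b} eq with a ℕ.<? b
... | yes a<b = a<b

<⇒<? : ∀ {a b} → a < b → ⌊ a ℕ.<? b ⌋ ≡ true
<⇒<? {a} {b} a<b with a ℕ.<? b
... | yes _ = refl
... | no a≮b = contradiction a<b a≮b

∧-true⁻ : ∀ {a b} → a ∧ b ≡ true → a ≡ true × b ≡ true
∧-true⁻ {true} {true} _ = refl , refl

incident : ∀ {n} → Fin n → Fin n × Fin n → Bool
incident u e = ⌊ u Fin.≟ proj₁ e ⌋ ∨ ⌊ u Fin.≟ proj₂ e ⌋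

incident-proj₁ : ∀ {n} (x y : Fin n) → incident x (x , y) ≡ true
incident-proj₁ x y with x Fin.≟ x
... | yes _ = refl
... | no x≢x = contradiction refl x≢x

incident-proj₂ : ∀ {n} (x y : Fin n) → incident y (x , y) ≡ true
incident-proj₂ x y with y Fin.≟ x
... | yes _ = refl
... | no _ with y Fin.≟ y
... | yes _ = refl
... | no y≢y = contradiction refl y≢y

incident⇒endpoint : ∀ {n} {u : Fin n} e → incident u e ≡ true → u ≡ proj₁ e ⊎ u ≡ proj₂ e
incident⇒endpoint {u = u} (x , y) inc with u Fin.≟ x
... | yes u≡x = inj₁ u≡x
... | no _ with u Fin.≟ y
... | yes u≡y = inj₂ u≡y
... | no _ with () ← inc

module MiddleGraph {n : ℕ} (G : Adj n) where

  E : ℕ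
  E = numEdges G

  M : Adj (n + E)
  M = middle G

  vert : Fin n → Fin (n + E)
  vert u = u ↑ˡ E

  edge : Fin E → Fin (n + E)
  edge a = n ↑ʳ a

  ends : Fin E → Fin n × Fin n
  ends a = lookup (edgeList G) a

  infix 4 _∈ₑ_
  _∈ₑ_ : Fin n → Fin E → Set
  x ∈ₑ a = incident x (ends a) ≡ true

  data View : Fin (n + E) → Set where
    vert-view : ∀ u → View (vert u)
    edge-view : ∀ a → View (edge a)

  view : ∀ x → View x
  view x with splitAt n x in eq
  ... | inj₁ u = subst View (splitAt⁻¹-↑ˡ eq) (vert-view u)
  ... | inj₂ a = subst View (splitAt⁻¹-↑ʳ eq) (edge-view a)

  M-vert-vert : ∀ u v → M (vert u) (vert v) ≡ false
  M-vert-vert u v rewrite splitAt-↑ˡ n u E | splitAt-↑ˡ n v E = refl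

  M-vert-edge : ∀ u a → M (vert u) (edge a) ≡ incident u (ends a)
  M-vert-edge u a rewrite splitAt-↑ˡ n u E | splitAt-↑ʳ n E a = refl

  M-edge-vert : ∀ u a → M (edge a) (vert u) ≡ incident u (ends a)
  M-edge-vert u a rewrite splitAt-↑ˡ n u E | splitAt-↑ʳ n E a = refl

  vert-injective : ∀ {u v} → vert u ≡ vert v → u ≡ v
  vert-injective {u} {v} eq with trans (sym (splitAt-↑ˡ n u E)) (trans (cong (splitAt n) eq) (splitAt-↑ˡ n v E))
  ... | refl = refl

  edge-injective : ∀ {a b} → edge a ≡ edge b → a ≡ b
  edge-injective {a} {b} eq with trans (sym (splitAt-↑ʳ n E a)) (trans (cong (splitAt n) eq) (splitAt-↑ʳ n E b))
  ... | refl = refl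

  vert≢edge : ∀ {u a} → vert u ≢ edge a
  vert≢edge {u} {a} eq with () ← trans (sym (splitAt-↑ˡ n u E)) (trans (cong (splitAt n) eq) (splitAt-↑ʳ n E a))

  private
    edgeList≡ : edgeList G ≡ filter (λ e → (⌊ toℕ (proj₁ e) ℕ.<? toℕ (proj₂ e) ⌋ ∧ G (proj₁ e) (proj₂ e)) Bool.≟ true)
                                   (List.cartesianProduct (allFin n) (allFin n))
    edgeList≡ = cong (filter _) (concatMap-pairs (allFin n) (allFin n))

  ends-sorted-adjacent : ∀ a → toℕ (proj₁ (ends a)) < toℕ (proj₂ (ends a)) × G (proj₁ (ends a)) (proj₂ (ends a)) ≡ true
  ends-sorted-adjacent a with ∧-true⁻ (proj₂ (∈-filter⁻ _ {xs = List.cartesianProduct (allFin n) (allFin n)}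
                                          (subst (ends a ∈_) edgeList≡ (∈-lookup a))))
  ... | i<j , adjacent = <?⇒< i<j , adjacent

  ends-surjective : ∀ i j → toℕ i < toℕ j → G i j ≡ true → ∃ λ a → ends a ≡ (i , j)
  ends-surjective i j i<j adjacent = Any.index ij∈ , sym (lookup-index ij∈)
    where
    ij∈ : (i , j) ∈ edgeList G
    ij∈ = subst ((i , j) ∈_) (sym edgeList≡)
            (∈-filter⁺ _ (∈-cartesianProduct⁺ (∈-allFin i) (∈-allFin j)) (cong₂ _∧_ (<⇒<? i<j) adjacent))

  ends-∈ₑ : ∀ {a i j} → ends a ≡ (i , j) → i ∈ₑ a × j ∈ₑ a
  ends-∈ₑ {i = i} {j} eq rewrite eq = incident-proj₁ i j , incident-proj₂ i j

  ends-injective : ∀ a b → ends a ≡ ends b → a ≡ b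
  ends-injective = Unique-lookup-injective
    (subst Unique (sym edgeList≡) (Unique.filter⁺ _ (Unique.cartesianProduct⁺ (Unique.allFin⁺ n) (Unique.allFin⁺ n))))

  ends-sorted : ∀ a {x w} → x ∈ₑ a → w ∈ₑ a → toℕ x < toℕ w → ends a ≡ (x , w)
  ends-sorted a {x} {w} x∈a w∈a x<w with ends a | proj₁ (ends-sorted-adjacent a)
                                        | incident⇒endpoint (ends a) x∈a | incident⇒endpoint (ends a) w∈a
  ... | _ | _   | inj₁ refl | inj₂ refl = refl
  ... | _ | _   | inj₁ refl | inj₁ refl = contradiction x<w (<-irrefl refl)
  ... | _ | _   | inj₂ refl | inj₂ refl = contradiction x<w (<-irrefl refl)
  ... | _ | p<q | inj₂ refl | inj₁ refl = contradiction x<w (<-asym p<q)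

  ∈ₑ-two-ends : ∀ a {x y z} → x ∈ₑ a → y ∈ₑ a → x ≢ y → z ∈ₑ a → z ≡ x ⊎ z ≡ y
  ∈ₑ-two-ends a {x} {y} x∈a y∈a x≢y z∈a with <-cmp (toℕ x) (toℕ y) | incident⇒endpoint (ends a) z∈a
  ... | tri< x<y _ _ | z≡end = subst (λ e → _ ≡ proj₁ e ⊎ _ ≡ proj₂ e) (ends-sorted a x∈a y∈a x<y) z≡end
  ... | tri≈ _ x≡y _ | _ = contradiction (toℕ-injective x≡y) x≢y
  ... | tri> _ _ y<x | z≡end = Sum.swap (subst (λ e → _ ≡ proj₁ e ⊎ _ ≡ proj₂ e) (ends-sorted a y∈a x∈a y<x) z≡end)

  edge-unique : ∀ a b {x y} → x ∈ₑ a → y ∈ₑ a → x ∈ₑ b → y ∈ₑ b → x ≢ y → a ≡ b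
  edge-unique a b {x} {y} x∈a y∈a x∈b y∈b x≢y with <-cmp (toℕ x) (toℕ y)
  ... | tri< x<y _ _ = ends-injective a b (trans (ends-sorted a x∈a y∈a x<y) (sym (ends-sorted b x∈b y∈b x<y)))
  ... | tri≈ _ x≡y _ = contradiction (toℕ-injective x≡y) x≢y
  ... | tri> _ _ y<x = ends-injective a b (trans (ends-sorted a y∈a x∈a y<x) (sym (ends-sorted b y∈b x∈b y<x)))

  ∈ₑ-avoiding : ∀ a u → ∃ λ x → x ∈ₑ a × x ≢ u
  ∈ₑ-avoiding a u with ends a | ends-sorted-adjacent a
  ... | (p , q) | p<q , _ with p Fin.≟ u
  ... | no p≢u = p , incident-proj₁ p q , p≢u
  ... | yes refl = q , incident-proj₂ p q , λ q≡p → <-irrefl (cong toℕ (sym q≡p)) p<q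

¬covered-by-two : ∀ {n} → 3 ≤ n → (v w : Fin n) → ¬ (∀ x → x ≡ v ⊎ x ≡ w)
¬covered-by-two (s≤s (s≤s (s≤s _))) v w covered with covered zero | covered (suc zero) | covered (suc (suc zero))
... | inj₁ refl | inj₁ () | _
... | inj₁ refl | inj₂ refl | inj₁ ()
... | inj₁ refl | inj₂ refl | inj₂ ()
... | inj₂ refl | inj₂ () | _
... | inj₂ refl | inj₁ refl | inj₁ ()
... | inj₂ refl | inj₁ refl | inj₂ ()

other-vertex : ∀ {n} → 2 ≤ n → (x : Fin n) → ∃ λ z → z ≢ x
other-vertex (s≤s (s≤s _)) zero = suc zero , λ ()
other-vertex (s≤s (s≤s _)) (suc x) = zero , λ ()

not≡true⇒≡false : ∀ {b} → not b ≡ true → b ≡ false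
not≡true⇒≡false {false} _ = refl

complement-true⁻ : ∀ {n} (G : Adj n) {c t} → complement G c t ≡ true → t ≢ c × G c t ≡ false
complement-true⁻ G {c} {t} Ḡct with c Fin.≟ t
... | no c≢t = c≢t ∘ sym , not≡true⇒≡false Ḡct

walk-exits-closed-neighbourhood : ∀ {n} (G : Adj n) (c : Fin n) {s z} → s ≡ c ⊎ G c s ≡ true → z ≢ c → G c z ≡ false →
  Walk G (λ _ → true) s z → ∃₂ λ s′ t → (s′ ≡ c ⊎ G c s′ ≡ true) × G s′ t ≡ true × t ≢ c × G c t ≡ false
walk-exits-closed-neighbourhood G c (inj₁ refl) z≢c _ here = contradiction refl z≢c
walk-exits-closed-neighbourhood G c (inj₂ Gcs) _ Gcz here with () ← trans (sym Gcs) Gcz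
walk-exits-closed-neighbourhood G c s∈ z≢c Gcz (step {w = t} Gst _ r) with t Fin.≟ c | G c t in Gct
... | yes t≡c | _ = walk-exits-closed-neighbourhood G c (inj₁ t≡c) z≢c Gcz r
... | no _ | true = walk-exits-closed-neighbourhood G c (inj₂ Gct) z≢c Gcz r
... | no t≢c | false = _ , t , s∈ , Gst , t≢c , Gct

record InternalEdge {n} (G : Adj n) : Set where
  field
    v w v′ w′ : Fin n
    vw : G v w ≡ true
    vv′ : G v v′ ≡ true
    ww′ : G w w′ ≡ true
    v′≢w : v′ ≢ w
    w′≢v : w′ ≢ v

module SimpleGraph {n : ℕ} (G : Adj n) (symmetric : Symmetric G) (irreflexive : Irreflexive G) where
  open MiddleGraph G

  adjacent⇒≢ : ∀ {x y} → G x y ≡ true → x ≢ y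
  adjacent⇒≢ {x} Gxy refl with () ← trans (sym (irreflexive x)) Gxy

  edge-joining : ∀ {x y} → G x y ≡ true → ∃ λ a → x ∈ₑ a × y ∈ₑ a
  edge-joining {x} {y} Gxy with <-cmp (toℕ x) (toℕ y)
  ... | tri< x<y _ _ = let (a , eq) = ends-surjective x y x<y Gxy in a , ends-∈ₑ eq
  ... | tri≈ _ x≡y _ = contradiction (toℕ-injective x≡y) (adjacent⇒≢ Gxy)
  ... | tri> _ _ y<x = let (a , eq) = ends-surjective y x y<x (trans (symmetric y x) Gxy)
                           (y∈a , x∈a) = ends-∈ₑ eq
                       in a , x∈a , y∈a

  ∈ₑ-adjacent : ∀ a {x y} → x ∈ₑ a → y ∈ₑ a → x ≢ y → G x y ≡ true
  ∈ₑ-adjacent a {x} {y} x∈a y∈a x≢y with <-cmp (toℕ x) (toℕ y)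
  ... | tri< x<y _ _ = subst (λ e → G (proj₁ e) (proj₂ e) ≡ true) (ends-sorted a x∈a y∈a x<y) (proj₂ (ends-sorted-adjacent a))
  ... | tri≈ _ x≡y _ = contradiction (toℕ-injective x≡y) x≢y
  ... | tri> _ _ y<x = trans (symmetric x y)
    (subst (λ e → G (proj₁ e) (proj₂ e) ≡ true) (ends-sorted a y∈a x∈a y<x) (proj₂ (ends-sorted-adjacent a)))

  ∈ₑ-neighbour : ∀ a {x} → x ∈ₑ a → ∃ λ y → G x y ≡ true × y ∈ₑ a
  ∈ₑ-neighbour a {x} x∈a with ends a | ends-sorted-adjacent a | incident⇒endpoint (ends a) x∈a
  ... | (p , q) | _ , Gpq | inj₁ refl = q , Gpq , incident-proj₂ p q
  ... | (p , q) | _ , Gpq | inj₂ refl = p , trans (symmetric q p) Gpq , incident-proj₁ p q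

  isLeaf : Fin n → Bool
  isLeaf x = ⌊ degree G x ℕ.≟ 1 ⌋

  Leaf : Fin n → Set
  Leaf x = isLeaf x ≡ true

  leaf-degree : ∀ {x} → Leaf x → card (G x) ≡ 1
  leaf-degree {x} leaf with degree G x ℕ.≟ 1
  ... | yes deg≡1 = trans (sym (count≡card (G x))) deg≡1

  leaf-neighbour : ∀ {x} → Leaf x → ∃ λ y → G x y ≡ true
  leaf-neighbour leaf = card≢0-witness _ λ card≡0 → case trans (sym (leaf-degree leaf)) card≡0 of λ ()

  leaf-neighbour-unique : ∀ {x y t} → Leaf x → G x y ≡ true → G x t ≡ true → t ≡ y
  leaf-neighbour-unique leaf = card≡1-unique _ (leaf-degree leaf)

  leaf-edge-unique : ∀ {x} → Leaf x → ∀ a b → x ∈ₑ a → x ∈ₑ b → a ≡ b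
  leaf-edge-unique leaf a b x∈a x∈b with ∈ₑ-neighbour a x∈a | ∈ₑ-neighbour b x∈b
  ... | y , Gxy , y∈a | y′ , Gxy′ , y′∈b =
    edge-unique a b x∈a y∈a x∈b (subst (_∈ₑ b) (leaf-neighbour-unique leaf Gxy Gxy′) y′∈b) (adjacent⇒≢ Gxy)

  module _ (connected : Connected G) (3≤n : 3 ≤ n) where

    no-isolated-edge : ∀ {v w} → (∀ t → G v t ≡ true → t ≡ w) → (∀ t → G w t ≡ true → t ≡ v) → ⊥
    no-isolated-edge {v} {w} v→w w→v = ¬covered-by-two 3≤n v w λ x → stays (inj₁ refl) (connected v x refl refl)
      where
      stays : ∀ {s x} → s ≡ v ⊎ s ≡ w → Walk G (λ _ → true) s x → x ≡ v ⊎ x ≡ w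
      stays s∈ here = s∈
      stays (inj₁ refl) (step Gst _ r) = stays (inj₂ (v→w _ Gst)) r
      stays (inj₂ refl) (step Gst _ r) = stays (inj₁ (w→v _ Gst)) r

    leaves-nonadjacent : ∀ {x y} → Leaf x → Leaf y → G x y ≡ true → ⊥
    leaves-nonadjacent leaf-x leaf-y Gxy = no-isolated-edge
      (λ t Gxt → leaf-neighbour-unique leaf-x Gxy Gxt) (λ t Gyt → leaf-neighbour-unique leaf-y (trans (symmetric _ _) Gxy) Gyt)

    module LowerBound (D : Fin (n + E) → Bool) (tocds : IsTOCDS M D) where

      dominating-edge : ∀ x → ∃ λ a → D (edge a) ≡ true × x ∈ₑ a
      dominating-edge x with proj₁ tocds (vert x)
      ... | u , Du , Mxu with view u
      ... | vert-view u′ with () ← trans (sym Mxu) (M-vert-vert x u′)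
      ... | edge-view a = a , Du , trans (sym (M-vert-edge x a)) Mxu

      leaf-outside⇒rest-inside : ∀ {x} → Leaf x → D (vert x) ≡ false → ∀ z → z ≢ vert x → D z ≡ true
      leaf-outside⇒rest-inside {x} leaf Dx≡false z z≢x with D z in Dz
      ... | true = refl
      ... | false with proj₂ tocds (vert x) z (cong not Dx≡false) (cong not Dz)
      ... | here = contradiction refl z≢x
      ... | step {w = u} Mxu ¬Du _ with view u
      ... | vert-view u′ with () ← trans (sym Mxu) (M-vert-vert x u′)
      ... | edge-view a with dominating-edge x
      ... | a′ , Da′ , x∈a′ with leaf-edge-unique leaf a a′ (trans (sym (M-vert-edge x a)) Mxu) x∈a′
      ... | refl with () ← subst (λ b → not b ≡ true) Da′ ¬Du

      leaves≤edges-in-D : card isLeaf ≤ card (λ a → D (edge a))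
      leaves≤edges-in-D = card-≤-injection isLeaf _ (λ x _ → proj₁ (dominating-edge x)) (λ x _ → proj₁ (proj₂ (dominating-edge x))) injective
        where
        injective : ∀ x y → Leaf x → Leaf y → proj₁ (dominating-edge x) ≡ proj₁ (dominating-edge y) → x ≡ y
        injective x y leaf-x leaf-y eq with x Fin.≟ y
        ... | yes x≡y = x≡y
        ... | no x≢y = ⊥-elim (leaves-nonadjacent leaf-x leaf-y
          (∈ₑ-adjacent _ (proj₂ (proj₂ (dominating-edge x))) (subst (y ∈ₑ_) (sym eq) (proj₂ (proj₂ (dominating-edge y)))) x≢y))

      representative : ∀ x → Leaf x → Fin n
      representative x leaf = if D (vert x) then x else proj₁ (leaf-neighbour leaf)

      representative-in-D : ∀ x leaf → D (vert (representative x leaf)) ≡ true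
      representative-in-D x leaf with D (vert x) in Dx
      ... | true = Dx
      ... | false = leaf-outside⇒rest-inside leaf Dx _ (adjacent⇒≢ (proj₂ (leaf-neighbour leaf)) ∘ sym ∘ vert-injective)

      representative-injective : ∀ x y leaf-x leaf-y → representative x leaf-x ≡ representative y leaf-y → x ≡ y
      representative-injective x y leaf-x leaf-y eq with D (vert x) in Dx | D (vert y) in Dy
      ... | true | true = eq
      ... | true | false = ⊥-elim (leaves-nonadjacent leaf-y leaf-x (subst (λ t → G y t ≡ true) (sym eq) (proj₂ (leaf-neighbour leaf-y))))
      ... | false | true = ⊥-elim (leaves-nonadjacent leaf-x leaf-y (subst (λ t → G x t ≡ true) eq (proj₂ (leaf-neighbour leaf-x))))
      ... | false | false with x Fin.≟ y
      ... | yes x≡y = x≡y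
      ... | no x≢y with () ← trans (sym Dy) (leaf-outside⇒rest-inside leaf-x Dx (vert y) (x≢y ∘ sym ∘ vert-injective))

      leaves≤vertices-in-D : card isLeaf ≤ card (λ u → D (vert u))
      leaves≤vertices-in-D = card-≤-injection isLeaf _ representative representative-in-D representative-injective

      2*leafCount≤count : 2 * leafCount G ≤ count D
      2*leafCount≤count = begin
        2 * leafCount G                                   ≡⟨ cong (2 *_) (count≡card isLeaf) ⟩
        card isLeaf + (card isLeaf + 0)                   ≤⟨ +-mono-≤ leaves≤vertices-in-D (+-mono-≤ leaves≤edges-in-D z≤n) ⟩
        card (D ∘ vert) + (card (D ∘ edge) + 0)           ≡⟨ cong (card (D ∘ vert) +_) (+-identityʳ _) ⟩
        card (D ∘ vert) + card (D ∘ edge)                 ≡⟨ card-↑ n D ⟨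
        card D                                            ≡⟨ count≡card D ⟨
        count D                                           ∎
        where open ≤-Reasoning

    has-neighbour : ∀ x → ∃ λ y → G x y ≡ true
    has-neighbour x with other-vertex (<⇒≤ 3≤n) x
    ... | z , z≢x with connected x z refl refl
    ... | here = contradiction refl z≢x
    ... | step Gxy _ _ = _ , Gxy

    branch-vertex : ∃ λ c → ∃₂ λ a b → G c a ≡ true × G c b ≡ true × a ≢ b
    branch-vertex with x₀ ← fromℕ< {n = n} (≤-trans (s≤s z≤n) 3≤n) | has-neighbour x₀
    ... | y , Gx₀y with any? (λ t → (G x₀ t Bool.≟ true) ×-dec ¬? (t Fin.≟ y))
    ... | yes (t , Gx₀t , t≢y) = x₀ , y , t , Gx₀y , Gx₀t , t≢y ∘ sym
    ... | no none₀ with any? (λ t → (G y t Bool.≟ true) ×-dec ¬? (t Fin.≟ x₀))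
    ... | yes (t , Gyt , t≢x₀) = y , x₀ , t , trans (symmetric y x₀) Gx₀y , Gyt , t≢x₀ ∘ sym
    ... | no none₁ = ⊥-elim (no-isolated-edge (only none₀) (only none₁))
      where
      only : ∀ {x y} → ¬ (∃ λ t → G x t ≡ true × t ≢ y) → ∀ t → G x t ≡ true → t ≡ y
      only {y = y} none t Gxt with t Fin.≟ y
      ... | yes t≡y = t≡y
      ... | no t≢y = ⊥-elim (none (t , Gxt , t≢y))

    module UpperBound (internal : InternalEdge G) where
      open InternalEdge internal

      e : Fin E
      e = proj₁ (edge-joining vw)

      v∈e : v ∈ₑ e
      v∈e = proj₁ (proj₂ (edge-joining vw))

      full : Fin (n + E) → Bool
      full _ = true

      D : Fin (n + E) → Bool
      D = (full ─ vert v) ─ edge e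

      D-∋ : ∀ x → x ≢ vert v → x ≢ edge e → D x ≡ true
      D-∋ x x≢v x≢e = ─-∋ (full ─ vert v) (─-∋ full refl x≢v) x≢e

      outside-D : ∀ x → not (D x) ≡ true → x ≡ vert v ⊎ x ≡ edge e
      outside-D x ¬Dx with ─-∌⁻ (full ─ vert v) (not≡true⇒≡false ¬Dx)
      ... | inj₂ x≡e = inj₂ x≡e
      ... | inj₁ ¬D′x with ─-∌⁻ full ¬D′x
      ... | inj₂ x≡v = inj₁ x≡v

      other-than-e : ∀ {a x} → x ∈ₑ a → x ≢ v → x ≢ w → a ≢ e
      other-than-e x∈a x≢v x≢w refl with ∈ₑ-two-ends e v∈e (proj₂ (proj₂ (edge-joining vw))) (adjacent⇒≢ vw) x∈a
      ... | inj₁ x≡v = x≢v x≡v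
      ... | inj₂ x≡w = x≢w x≡w

      dominated-by : ∀ {y x} a → y ∈ₑ a → x ∈ₑ a → x ≢ v → x ≢ w → ∃ λ u → D u ≡ true × M (vert y) u ≡ true
      dominated-by {y} a y∈a x∈a x≢v x≢w =
        edge a , D-∋ _ (vert≢edge ∘ sym) (other-than-e x∈a x≢v x≢w ∘ edge-injective) , trans (M-vert-edge y a) y∈a

      dominating : TotalDominating M D
      dominating x with view x
      dominating _ | vert-view y with y Fin.≟ v | y Fin.≟ w
      ... | yes refl | _ = let (a , v∈a , v′∈a) = edge-joining vv′ in dominated-by a v∈a v′∈a (adjacent⇒≢ vv′ ∘ sym) v′≢w
      ... | no _ | yes refl = let (a , w∈a , w′∈a) = edge-joining ww′ in dominated-by a w∈a w′∈a w′≢v (adjacent⇒≢ ww′ ∘ sym)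
      ... | no y≢v | no y≢w = let (a , y∈a , _) = edge-joining (proj₂ (has-neighbour y)) in dominated-by a y∈a y∈a y≢v y≢w
      dominating _ | edge-view a with ∈ₑ-avoiding a v
      ... | y , y∈a , y≢v = vert y , D-∋ _ (y≢v ∘ vert-injective) vert≢edge , trans (M-edge-vert y a) y∈a

      outer-connected : InducedConnected M (λ x → not (D x))
      outer-connected x y ¬Dx ¬Dy with outside-D x ¬Dx | outside-D y ¬Dy
      ... | inj₁ refl | inj₁ refl = here
      ... | inj₂ refl | inj₂ refl = here
      ... | inj₁ refl | inj₂ refl = step (trans (M-vert-edge v e) v∈e) ¬Dy here
      ... | inj₂ refl | inj₁ refl = step (trans (M-edge-vert v e) v∈e) ¬Dy here

      tocds : IsTOCDS M D
      tocds = dominating , outer-connected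

      count+2 : count D + 2 ≡ n + E
      count+2 = begin
        count D + 2                 ≡⟨ cong (_+ 2) (count≡card D) ⟩
        card D + 2                  ≡⟨ +-comm _ 2 ⟩
        suc (suc (card D))          ≡⟨ cong suc (card-─-suc (full ─ vert v) {edge e} (─-∋ full refl (vert≢edge ∘ sym))) ⟨
        suc (card (full ─ vert v))  ≡⟨ card-─-suc full {vert v} refl ⟨
        card full                   ≡⟨ card-full (n + E) ⟩
        n + E                       ∎
        where open ≡-Reasoning

    module _ (co-connected : Connected (complement G)) where

      non-neighbour : ∀ c → ∃ λ t → t ≢ c × G c t ≡ false
      non-neighbour c with other-vertex (<⇒≤ 3≤n) c
      ... | z , z≢c with co-connected c z refl refl
      ... | here = contradiction refl z≢c
      ... | step Ḡct _ _ = _ , complement-true⁻ G Ḡct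

      -- Leaving the closed neighbourhood of a branch vertex c towards a non-neighbour of c crosses an internal edge at c.
      internal-edge : InternalEdge G
      internal-edge with branch-vertex
      ... | c , a , b , Gca , Gcb , a≢b with non-neighbour c
      ... | t₀ , t₀≢c , Gct₀ with walk-exits-closed-neighbourhood G c (inj₁ refl) t₀≢c Gct₀ (connected c t₀ refl refl)
      ... | s , t , inj₁ refl , Gst , t≢c , Gct with () ← trans (sym Gst) Gct
      ... | s , t , inj₂ Gcs , Gst , t≢c , Gct with a Fin.≟ s
      ... | no a≢s = record { v = c ; w = s ; v′ = a ; w′ = t ; vw = Gcs ; vv′ = Gca ; ww′ = Gst ; v′≢w = a≢s ; w′≢v = t≢c }
      ... | yes refl = record { v = c ; w = a ; v′ = b ; w′ = t ; vw = Gca ; vv′ = Gcb ; ww′ = Gst ; v′≢w = a≢b ∘ sym ; w′≢v = t≢c }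

γtc-middle-bounds : ∀ {n} (G : Adj n) → Symmetric G → Irreflexive G → Connected G → Connected (complement G) → 3 ≤ n →
  ∃ λ k → IsGammaTC (middle G) k × 2 * leafCount G ≤ k × k + 2 ≤ n + numEdges G
γtc-middle-bounds {n} G symmetric irreflexive connected co-connected 3≤n =
  from-internal-edge (internal-edge connected 3≤n co-connected)
  where
  open SimpleGraph G symmetric irreflexive
  from-internal-edge : InternalEdge G → ∃ λ k → IsGammaTC (middle G) k × 2 * leafCount G ≤ k × k + 2 ≤ n + numEdges G
  from-internal-edge internal =
    let open UpperBound connected 3≤n internal
        (k , γtc , k≤count) = γtc-exists (middle G) D tocds
        ((D₀ , tocds₀ , count≡k) , _) = γtc
    in k , γtc , subst (2 * leafCount G ≤_) count≡k (LowerBound.2*leafCount≤count connected 3≤n D₀ tocds₀) ,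
       ≤-trans (+-monoˡ-≤ 2 k≤count) (≤-reflexive count+2)

length-filter-rows : ∀ {n k} (P : Fin n × Fin n → Bool) (f : Fin k → Fin n) →
  length (filter (λ e → P e Bool.≟ true) (concatMap (λ i → List.map (i ,_) (allFin n)) (tabulate f)))
    ≡ ∑ (λ i → card (λ j → P (f i , j)))
length-filter-rows {k = zero} P f = refl
length-filter-rows {n} {suc k} P f = begin
  length (filter P? (row (f zero) List.++ rows (f ∘ suc)))
    ≡⟨ cong length (filter-++ P? (row (f zero)) (rows (f ∘ suc))) ⟩
  length (filter P? (row (f zero)) List.++ filter P? (rows (f ∘ suc)))
    ≡⟨ length-++ (filter P? (row (f zero))) ⟩
  length (filter P? (row (f zero))) + length (filter P? (rows (f ∘ suc)))
    ≡⟨ cong₂ _+_ (trans (cong (length ∘ filter P?) (map-tabulate id (f zero ,_))) (length-filter-tabulate P (f zero ,_)))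
                 (length-filter-rows P (f ∘ suc)) ⟩
  card (λ j → P (f zero , j)) + ∑ (λ i → card (λ j → P (f (suc i) , j))) ∎
  where
  open ≡-Reasoning
  P? = λ e → P e Bool.≟ true
  row : Fin n → List (Fin n × Fin n)
  row i = List.map (i ,_) (allFin n)
  rows : ∀ {k} → (Fin k → Fin n) → List (Fin n × Fin n)
  rows g = concatMap row (tabulate g)

card-above : ∀ n a → card {n} (λ j → ⌊ a ℕ.<? toℕ j ⌋) ≡ n ∸ suc a
card-above zero a = refl
card-above (suc n) zero = trans (card-cong {n} (λ j → <⇒<? {0} {suc (toℕ j)} (s≤s z≤n))) (card-full n)
card-above (suc n) (suc a) = trans (card-cong {n} (λ j → suc<?suc a (toℕ j))) (card-above n a)
  where
  suc<?suc : ∀ a b → ⌊ suc a ℕ.<? suc b ⌋ ≡ ⌊ a ℕ.<? b ⌋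
  suc<?suc a b with a ℕ.<? b
  ... | yes a<b = <⇒<? (s≤s a<b)
  ... | no a≮b with suc a ℕ.<? suc b
  ...   | yes a+1<b+1 = contradiction (≤-pred a+1<b+1) a≮b
  ...   | no _ = refl

triangular : ∀ n → 2 * ∑ {n} (λ i → n ∸ suc (toℕ i)) + n ≡ n * n
triangular zero = refl
triangular (suc n) = begin
  2 * (n + s) + suc n     ≡⟨ lemma n s ⟩
  (2 * s + n) + (2 * n + 1) ≡⟨ cong (_+ (2 * n + 1)) (triangular n) ⟩
  n * n + (2 * n + 1)     ≡⟨ square-suc n ⟩
  suc n * suc n           ∎
  where
  open ≡-Reasoning
  s = ∑ {n} (λ i → n ∸ suc (toℕ i))
  lemma : ∀ n s → 2 * (n + s) + suc n ≡ (2 * s + n) + (2 * n + 1)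
  lemma = solve-∀
  square-suc : ∀ n → n * n + (2 * n + 1) ≡ suc n * suc n
  square-suc = solve-∀

complement-≢ : ∀ {n} (G : Adj n) {i j} → i ≢ j → complement G i j ≡ not (G i j)
complement-≢ G {i} {j} i≢j with i Fin.≟ j
... | yes i≡j = contradiction i≡j i≢j
... | no _ = refl

-- Each pair i < j is an edge of exactly one of G and its complement.
numEdges+numEdges-complement : ∀ {n} (G : Adj n) → 2 * (numEdges G + numEdges (complement G)) + n ≡ n * n
numEdges+numEdges-complement {n} G = begin
  2 * (numEdges G + numEdges (complement G)) + n
    ≡⟨ cong (λ k → 2 * k + n) (begin
        numEdges G + numEdges (complement G)
          ≡⟨ cong₂ _+_ (length-filter-rows (below G) id) (length-filter-rows (below (complement G)) id) ⟩
        ∑ (λ i → card (row G i)) + ∑ (λ i → card (row (complement G) i))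
          ≡⟨ ∑-+ (card ∘ row G) (card ∘ row (complement G)) ⟩
        ∑ (λ i → card (row G i) + card (row (complement G) i))
          ≡⟨ ∑-cong (λ i → trans (∑-+ (indicator ∘ row G i) (indicator ∘ row (complement G) i)) (∑-cong (split i))) ⟩
        ∑ {n} (λ i → card {n} (λ j → ⌊ toℕ i ℕ.<? toℕ j ⌋))
          ≡⟨ ∑-cong {n} (λ i → card-above n (toℕ i)) ⟩
        ∑ {n} (λ i → n ∸ suc (toℕ i)) ∎) ⟩
  2 * ∑ {n} (λ i → n ∸ suc (toℕ i)) + n
    ≡⟨ triangular n ⟩
  n * n ∎
  where
  open ≡-Reasoning
  below : Adj n → Fin n × Fin n → Bool
  below H e = ⌊ toℕ (proj₁ e) ℕ.<? toℕ (proj₂ e) ⌋ ∧ H (proj₁ e) (proj₂ e)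
  row : Adj n → Fin n → Fin n → Bool
  row H i j = below H (i , j)
  split : ∀ i j → indicator (row G i j) + indicator (row (complement G) i j) ≡ indicator ⌊ toℕ i ℕ.<? toℕ j ⌋
  split i j with ⌊ toℕ i ℕ.<? toℕ j ⌋ in i<j
  ... | false = refl
  ... | true rewrite complement-≢ G (λ i≡j → <-irrefl (cong toℕ i≡j) (<?⇒< i<j)) with G i j
  ...   | true = refl
  ...   | false = refl

complement-symmetric : ∀ {n} (G : Adj n) → Symmetric G → Symmetric (complement G)
complement-symmetric G symmetric u v with u Fin.≟ v | v Fin.≟ u
... | yes _ | yes _ = refl
... | no _ | no _ = cong not (symmetric u v)
... | yes refl | no v≢u = contradiction refl v≢u
... | no u≢v | yes refl = contradiction refl u≢v

complement-irreflexive : ∀ {n} (G : Adj n) → Irreflexive (complement G)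
complement-irreflexive G u with u Fin.≟ u
... | yes _ = refl
... | no u≢u = contradiction refl u≢u

complement-involutive : ∀ {n} (G : Adj n) → Irreflexive G → ∀ u v → G u v ≡ complement (complement G) u v
complement-involutive G irreflexive u v with u Fin.≟ v
... | yes refl = irreflexive u
... | no _ = sym (not-involutive (G u v))

complement²-connected : ∀ {n} (G : Adj n) → Irreflexive G → Connected G → Connected (complement (complement G))
complement²-connected G irreflexive connected u v _ _ = walk-resp (complement-involutive G irreflexive) (connected u v refl refl)

2[k₁+k₂]≤n²+3n∸8 : ∀ n k₁ k₂ m₁ m₂ → k₁ + 2 ≤ n + m₁ → k₂ + 2 ≤ n + m₂ → 2 * (m₁ + m₂) + n ≡ n * n →
  2 * (k₁ + k₂) ≤ n * n + 3 * n ∸ 8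
2[k₁+k₂]≤n²+3n∸8 n k₁ k₂ m₁ m₂ k₁+2≤ k₂+2≤ edges = m+n≤o⇒m≤o∸n (2 * (k₁ + k₂)) (begin
  2 * (k₁ + k₂) + 8              ≡⟨ regroup k₁ k₂ ⟩
  2 * ((k₁ + 2) + (k₂ + 2))      ≤⟨ *-monoʳ-≤ 2 (+-mono-≤ k₁+2≤ k₂+2≤) ⟩
  2 * ((n + m₁) + (n + m₂))      ≡⟨ expand n m₁ m₂ ⟩
  (2 * (m₁ + m₂) + n) + 3 * n    ≡⟨ cong (_+ 3 * n) edges ⟩
  n * n + 3 * n                  ∎)
  where
  open ≤-Reasoning
  regroup : ∀ a b → 2 * (a + b) + 8 ≡ 2 * ((a + 2) + (b + 2))
  regroup = solve-∀
  expand : ∀ n p q → 2 * ((n + p) + (n + q)) ≡ (2 * (p + q) + n) + 3 * n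
  expand = solve-∀

theorem5p3 : (n : ℕ) (T : Adj n) → 4 ≤ n → IsTree T → Connected (complement T)
    → ∃₂ λ k₁ k₂ → IsGammaTC (middle T) k₁ × IsGammaTC (middle (complement T)) k₂
        × 2 * leafCount T + 2 * leafCount (complement T) ≤ k₁ + k₂
        × 2 * (k₁ + k₂) ≤ n * n + 3 * n ∸ 8
theorem5p3 n T 4≤n ((symmetric , irreflexive) , connected , _) co-connected =
  let 3≤n = <⇒≤ 4≤n
      (k₁ , γ₁ , lower₁ , upper₁) = γtc-middle-bounds T symmetric irreflexive connected co-connected 3≤n
      (k₂ , γ₂ , lower₂ , upper₂) = γtc-middle-bounds (complement T) (complement-symmetric T symmetric)
        (complement-irreflexive T) co-connected (complement²-connected T irreflexive connected) 3≤n
  in k₁ , k₂ , γ₁ , γ₂ , +-mono-≤ lower₁ lower₂ ,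
     2[k₁+k₂]≤n²+3n∸8 n k₁ k₂ (numEdges T) (numEdges (complement T)) upper₁ upper₂ (numEdges+numEdges-complement T)
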